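{- Let $A,B,C,C'\in\mathbb{F}_2^{m\times m}$ and suppose that $t(A,B,C)=t(A,B,C')=0$. Then there exists $L\in\mathcal{L}$ such that $LC=C'$.
   Context: $\mathbb{F}_2=\{0,1\}$ is the field with two elements and $\mathbb{F}_2^{m\times m}$ the set of $m\times m$ matrices over $\mathbb{F}_2$. For $C_1,\dots,C_s\in\mathbb{F}_2^{m\times m}$, the digital net generated by $(C_1,\dots,C_s)$ is the point set $\{\mathbf{x}_0,\dots,\mathbf{x}_{2^m-1}\}\subset[0,1)^s$ defined as follows: for $0\le l<2^m$ write $l=\iota_0+\iota_1 2+\dots+\iota_{m-1}2^{m-1}$ with $\iota_k\in\mathbb{F}_2$, put $\mathbf{y}_{l,j}=C_j(\iota_0,\dots,\iota_{m-1})^\top\in\mathbb{F}_2^m$ and $\mathbf{x}_l=(\phi(\mathbf{y}_{l,1}),\dots,\phi(\mathbf{y}_{l,s}))$, where $\phi((y_1,\dots,y_m)^\top)=\sum_{k=1}^m y_k 2^{ -k}$. For $0\le t\le m$, a point set $\{\mathbf{x}_0,\dots,\mathbf{x}_{2^m-1}\}\subset[0,1)^s$ is a $(t,m,s)$-net over $\mathbb{F}_2$ if for all nonnegative integers $d_1,\dots,d_s$ with $d_1+\dots+d_s=m-t$, every elementary interval $\prod_{i=1}^s[a_i/2^{d_i},(a_i+1)/2^{d_i})$ with integers $0\le a_i<2^{d_i}$ contains exactly $2^t$ of the points (counted with multiplicity). $t(C_1,\dots,C_s)$ denotes the $t$-value of the digital net generated by $(C_1,\dots,C_s)$, i.e.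 the least $t$ for which it is a $(t,m,s)$-net over $\mathbb{F}_2$. $\mathcal{L}$ denotes the set of non-singular lower-triangular $m\times m$ matrices over $\mathbb{F}_2$ (i.e. lower-triangular with all diagonal entries $1$). -}

module Defs where

open import Data.Bool using (Bool; true; false; _∧_; _xor_; if_then_else_)
open import Data.Nat using (ℕ; zero; suc; _+_; _*_; _∸_; _^_; _≤_; _<_; _%_; _/_; _≡ᵇ_; _≤ᵇ_; _<ᵇ_)
open import Data.Fin using (Fin; toℕ) renaming (zero to fzero; suc to fsuc)
open import Data.List using (List; foldr; map; allFin; upTo)
open import Data.Nat.ListAction using (sum)
open import Data.Bool.ListAction using (and)
open import Data.Product using (_×_)
open import Relation.Binary.PropositionalEquality using (_≡_)
open import Relation.Nullary using (¬_)

-- Matrices over F₂ = Bool (false = 0, true = 1, xor = +, ∧ = ·).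
-- M i j is the entry in row i, column j (indices 0-based).
Mat : ℕ → Set
Mat m = Fin m → Fin m → Bool

dot : ∀ {m} → (Fin m → Bool) → (Fin m → Bool) → Bool
dot {m} u v = foldr _xor_ false (map (λ k → u k ∧ v k) (allFin m))

_·ᵥ_ : ∀ {m} → Mat m → (Fin m → Bool) → (Fin m → Bool)
(M ·ᵥ v) i = dot (M i) v

_·ₘ_ : ∀ {m} → Mat m → Mat m → Mat m
(L ·ₘ C) i j = dot (L i) (λ k → C k j)

-- binary digits: bitsOf m l k = ι_k where l = ι_0 + ι_1 2 + ... + ι_{m-1} 2^{m-1}
bitsOf : (m : ℕ) → ℕ → Fin m → Bool
bitsOf (suc m) l fzero    = l % 2 ≡ᵇ 1
bitsOf (suc m) l (fsuc k) = bitsOf m (l / 2) k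

-- 2^m · φ(y) = Σ_{k=1}^m y_k 2^{m-k}  (index k-1 in Fin m holds y_k)
scaledφ : (m : ℕ) → (Fin m → Bool) → ℕ
scaledφ zero    y = 0
scaledφ (suc m) y = (if y fzero then 2 ^ m else 0) + scaledφ m (λ k → y (fsuc k))

-- 2^m times the j-th coordinate of the point x_l of the digital net generated by Cs
scaledCoord : (m s : ℕ) → (Fin s → Mat m) → ℕ → Fin s → ℕ
scaledCoord m s Cs l j = scaledφ m (Cs j ·ᵥ bitsOf m l)

-- x_l lies in the elementary interval ∏ [a_i/2^{d_i}, (a_i+1)/2^{d_i}),
-- checked after multiplying everything by 2^m (valid as d_i ≤ m):
-- a_i 2^{m-d_i} ≤ 2^m x_{l,i} < (a_i+1) 2^{m-d_i}
inBox : (m s : ℕ) → (Fin s → Mat m) → (d a : Fin s → ℕ) → ℕ → Bool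
inBox m s Cs d a l =
  and (map (λ i → (a i * 2 ^ (m ∸ d i) ≤ᵇ scaledCoord m s Cs l i)
                ∧ (scaledCoord m s Cs l i <ᵇ suc (a i) * 2 ^ (m ∸ d i)))
           (allFin s))

countInBox : (m s : ℕ) → (Fin s → Mat m) → (d a : Fin s → ℕ) → ℕ
countInBox m s Cs d a =
  sum (map (λ l → if inBox m s Cs d a l then 1 else 0) (upTo (2 ^ m)))

IsNet : (m s : ℕ) → (Fin s → Mat m) → ℕ → Set
IsNet m s Cs t =
  t ≤ m ×
  ((d : Fin s → ℕ) → sum (map d (allFin s)) ≡ m ∸ t →
   (a : Fin s → ℕ) → ((i : Fin s) → a i < 2 ^ d i) →
   countInBox m s Cs d a ≡ 2 ^ t)

HasTValue : (m s : ℕ) → (Fin s → Mat m) → ℕ → Set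
HasTValue m s Cs t = IsNet m s Cs t × ((t' : ℕ) → t' < t → ¬ IsNet m s Cs t')

IsUnitLowerTriangular : ∀ {m} → Mat m → Set
IsUnitLowerTriangular L =
  ((i j : Fin _) → toℕ i < toℕ j → L i j ≡ false) × ((i : Fin _) → L i i ≡ true)

-- For a digital (0,m,3)-net generated by (A,B,C) and any d₁ + d₂ + d₃ = m, every elementary box holds
-- exactly one point, i.e. x ↦ (first d₁ entries of Ax, first d₂ of Bx, first d₃ of Cx) is a bijection
-- of F₂^m. Write C_k for the first k rows of C. By induction on k, ker C_k ⊆ ker C'_k and rows k of C
-- and C' agree on ker C_k: the linear form x ↦ (Cx)_k + (C'x)_k vanishes on ker C_k ∩ ker A_{m-k} = 0,
-- and ker C_k ∩ ker A_p is spanned by ker C_k ∩ ker A_{p+1} and a vector v with (Av)_p = (Cv)_k =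
-- (C'v)_k = 1, which the profile (p, m-k-p-1, k+1) of both nets provides. If C x_j = e_j, then x_j lies
-- in ker C_j, so L = C' C⁻¹, whose column j is C' x_j, is lower triangular with unit diagonal.

module Submission where

open import Defs
open import Algebra.Bundles using (CommutativeRing)
open import Data.Bool using (Bool; true; false; _∧_; _xor_; if_then_else_; T)
open import Data.Bool.ListAction using (and)
open import Data.Bool.Properties
  using (xor-∧-commutativeRing; xor-identityʳ; xor-same; ∧-assoc; ∧-comm; ∧-zeroʳ; ∧-distribˡ-xor; T-∧; ¬-not)
open import Data.Fin using (Fin; toℕ; fromℕ<) renaming (zero to fzero; suc to fsuc)
open import Data.Fin.Properties using (toℕ-injective; toℕ<n; toℕ-fromℕ<)
import Data.List as List
open import Data.List using (List; foldr; map; tabulate; allFin; upTo)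
open import Data.List.Membership.Propositional using (_∈_)
open import Data.List.Membership.Propositional.Properties using (∈-upTo⁺)
open import Data.List.Properties using (map-tabulate)
import Data.List.Relation.Unary.All.Properties as All
open import Data.List.Relation.Unary.Any using (here; there)
open import Data.Nat
  using (ℕ; zero; suc; _+_; _*_; _∸_; _^_; _≤_; _<_; _≤ᵇ_; _<ᵇ_; _≡ᵇ_; _%_; _/_; z≤n; s≤s; s≤s⁻¹; z<s; s<s; _≟_)
open import Data.Nat.DivMod using ([m+kn]%n≡m%n; +-distrib-/-∣ʳ; m<n⇒m/n≡0; m*n/n≡m)
open import Data.Nat.Divisibility using (divides)
import Data.Nat.ListAction as ℕ
open import Data.Nat.Properties
  using ( ≤-reflexive; ≤-trans; ≤-antisym; ≤-<-trans; <⇒≤; <⇒≱; n≤1+n; n<1+n; m<n⇒m<1+n; m≤n⇒m<n∨m≡n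
        ; m≤m+n; m≤n+m; m<m+n; +-mono-≤; +-monoˡ-≤; +-monoʳ-<; *-monoˡ-≤; *-cancelʳ-<
        ; +-comm; +-assoc; +-suc; +-identityʳ; +-cancelˡ-≡; *-comm; *-distribʳ-+
        ; ^-distribˡ-+-*; m^n>0; m+[n∸m]≡n; m∸n+n≡m; ≤ᵇ⇒≤; <ᵇ⇒<; ≤⇒≤ᵇ; <⇒<ᵇ; module ≤-Reasoning )
open import Data.Product using (Σ; _×_; _,_; proj₁; proj₂)
open import Data.Sum using (inj₁; inj₂)
open import Data.Vec.Functional using ([]; _∷_)
open import Function using (_∘_; id)
open import Function.Bundles using (_⇔_; mk⇔; Equivalence)
open import Relation.Binary.PropositionalEquality using (_≡_; _≢_; refl; sym; trans; cong; cong₂; subst; module ≡-Reasoning)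
open import Relation.Nullary using (¬_; contradiction; yes; no)

private module F₂ = CommutativeRing xor-∧-commutativeRing
open import Algebra.Properties.CommutativeSemigroup F₂.+-commutativeSemigroup using (interchange)
open import Algebra.Properties.Semiring.Sum F₂.semiring
  using (sum-syntax; sum-cong-≗; sum-replicate-zero; ∑-distrib-+; ∑-comm; *-distribˡ-sum; *-distribʳ-sum)
open import Algebra.Properties.Group F₂.+-group using () renaming (x∙y⁻¹≈ε⇒x≈y to xor≡false⇒≡)

-- Matrices over F₂

𝟙 : ∀ {m} → Mat m
𝟙 fzero    fzero    = true
𝟙 fzero    (fsuc j) = false
𝟙 (fsuc i) fzero    = false
𝟙 (fsuc i) (fsuc j) = 𝟙 i j

𝟙-diag : ∀ {m} (i : Fin m) → 𝟙 i i ≡ true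
𝟙-diag fzero    = refl
𝟙-diag (fsuc i) = 𝟙-diag i

𝟙-upper : ∀ {m} (i j : Fin m) → toℕ i < toℕ j → 𝟙 i j ≡ false
𝟙-upper fzero    (fsuc j) _         = refl
𝟙-upper (fsuc i) (fsuc j) (s≤s i<j) = 𝟙-upper i j i<j

𝟙-sym : ∀ {m} (i j : Fin m) → 𝟙 i j ≡ 𝟙 j i
𝟙-sym fzero    fzero    = refl
𝟙-sym fzero    (fsuc j) = refl
𝟙-sym (fsuc i) fzero    = refl
𝟙-sym (fsuc i) (fsuc j) = 𝟙-sym i j

∑-𝟙ˡ : ∀ {m} (i : Fin m) (f : Fin m → Bool) → ∑[ k < m ] (𝟙 i k ∧ f k) ≡ f i
∑-𝟙ˡ {suc m} fzero    f = trans (cong (f fzero xor_) (sum-replicate-zero m)) (xor-identityʳ (f fzero))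
∑-𝟙ˡ {suc m} (fsuc i) f = ∑-𝟙ˡ i (f ∘ fsuc)

∑-𝟙ʳ : ∀ {m} (j : Fin m) (f : Fin m → Bool) → ∑[ k < m ] (f k ∧ 𝟙 k j) ≡ f j
∑-𝟙ʳ j f = trans (sum-cong-≗ (λ k → trans (∧-comm (f k) _) (cong (_∧ f k) (𝟙-sym k j)))) (∑-𝟙ˡ j f)

foldr-xor-map-tabulate : ∀ {n} {A : Set} (f : A → Bool) (g : Fin n → A) →
                         foldr _xor_ false (map f (tabulate g)) ≡ ∑[ k < n ] f (g k)
foldr-xor-map-tabulate {zero}  f g = refl
foldr-xor-map-tabulate {suc n} f g = cong (f (g fzero) xor_) (foldr-xor-map-tabulate f (g ∘ fsuc))

dot≡∑ : ∀ {m} (u v : Fin m → Bool) → dot u v ≡ ∑[ k < m ] (u k ∧ v k)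
dot≡∑ u v = foldr-xor-map-tabulate (λ k → u k ∧ v k) (λ k → k)

dot-cong : ∀ {m} {u u' v v' : Fin m → Bool} → (∀ k → u k ≡ u' k) → (∀ k → v k ≡ v' k) → dot u v ≡ dot u' v'
dot-cong {m} {u} {u'} {v} {v'} u≗u' v≗v' = begin
  dot u v                    ≡⟨ dot≡∑ u v ⟩
  ∑[ k < m ] (u k ∧ v k)     ≡⟨ sum-cong-≗ (λ k → cong₂ _∧_ (u≗u' k) (v≗v' k)) ⟩
  ∑[ k < m ] (u' k ∧ v' k)   ≡⟨ dot≡∑ u' v' ⟨
  dot u' v'                  ∎
  where open ≡-Reasoning

·ᵥ-cong : ∀ {m} (M : Mat m) {x y : Fin m → Bool} → (∀ k → x k ≡ y k) → ∀ i → (M ·ᵥ x) i ≡ (M ·ᵥ y) i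
·ᵥ-cong M x≗y i = dot-cong (λ _ → refl) x≗y

·ₘ-congˡ : ∀ {m} {N N' : Mat m} (P : Mat m) → (∀ i j → N i j ≡ N' i j) → ∀ i j → (N ·ₘ P) i j ≡ (N' ·ₘ P) i j
·ₘ-congˡ P N≗N' i j = dot-cong (N≗N' i) (λ _ → refl)

·ₘ-congʳ : ∀ {m} (M : Mat m) {N N' : Mat m} → (∀ i j → N i j ≡ N' i j) → ∀ i j → (M ·ₘ N) i j ≡ (M ·ₘ N') i j
·ₘ-congʳ M N≗N' i j = dot-cong (λ _ → refl) (λ k → N≗N' k j)

·ᵥ-xor : ∀ {m} (M : Mat m) (x y : Fin m → Bool) i → (M ·ᵥ (λ k → x k xor y k)) i ≡ (M ·ᵥ x) i xor (M ·ᵥ y) i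
·ᵥ-xor M x y i = begin
  dot (M i) (λ k → x k xor y k)                          ≡⟨ dot≡∑ (M i) _ ⟩
  ∑[ k < _ ] (M i k ∧ (x k xor y k))                     ≡⟨ sum-cong-≗ (λ k → ∧-distribˡ-xor (M i k) (x k) (y k)) ⟩
  ∑[ k < _ ] ((M i k ∧ x k) xor (M i k ∧ y k))           ≡⟨ ∑-distrib-+ (λ k → M i k ∧ x k) (λ k → M i k ∧ y k) ⟩
  ∑[ k < _ ] (M i k ∧ x k) xor ∑[ k < _ ] (M i k ∧ y k)  ≡⟨ cong₂ _xor_ (dot≡∑ (M i) x) (dot≡∑ (M i) y) ⟨
  dot (M i) x xor dot (M i) y                            ∎
  where open ≡-Reasoning

·ᵥ-zero : ∀ {m} (M : Mat m) {x : Fin m → Bool} → (∀ k → x k ≡ false) → ∀ i → (M ·ᵥ x) i ≡ false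
·ᵥ-zero {m} M {x} x≗0 i = begin
  dot (M i) x               ≡⟨ dot≡∑ (M i) x ⟩
  ∑[ k < m ] (M i k ∧ x k)  ≡⟨ sum-cong-≗ (λ k → trans (cong (M i k ∧_) (x≗0 k)) (∧-zeroʳ (M i k))) ⟩
  ∑[ k < m ] false          ≡⟨ sum-replicate-zero m ⟩
  false                     ∎
  where open ≡-Reasoning

·ₘ-identityˡ : ∀ {m} (M : Mat m) i j → (𝟙 ·ₘ M) i j ≡ M i j
·ₘ-identityˡ M i j = trans (dot≡∑ (𝟙 i) _) (∑-𝟙ˡ i (λ k → M k j))

·ₘ-identityʳ : ∀ {m} (M : Mat m) i j → (M ·ₘ 𝟙) i j ≡ M i j
·ₘ-identityʳ M i j = trans (dot≡∑ (M i) _) (∑-𝟙ʳ j (M i))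

·ₘ-assoc : ∀ {m} (M N P : Mat m) i j → ((M ·ₘ N) ·ₘ P) i j ≡ (M ·ₘ (N ·ₘ P)) i j
·ₘ-assoc {m} M N P i j = begin
  dot (λ k → dot (M i) (λ l → N l k)) (λ k → P k j)         ≡⟨ dot≡∑ (λ k → dot (M i) (λ l → N l k)) (λ k → P k j) ⟩
  ∑[ k < m ] (dot (M i) (λ l → N l k) ∧ P k j)              ≡⟨ sum-cong-≗ (λ k → cong (_∧ P k j) (dot≡∑ (M i) (λ l → N l k))) ⟩
  ∑[ k < m ] (∑[ l < m ] (M i l ∧ N l k) ∧ P k j)           ≡⟨ sum-cong-≗ (λ k → *-distribʳ-sum (P k j) (λ l → M i l ∧ N l k)) ⟩
  ∑[ k < m ] ∑[ l < m ] ((M i l ∧ N l k) ∧ P k j)           ≡⟨ ∑-comm (λ k l → (M i l ∧ N l k) ∧ P k j) ⟩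
  ∑[ l < m ] ∑[ k < m ] ((M i l ∧ N l k) ∧ P k j)           ≡⟨ sum-cong-≗ (λ l → sum-cong-≗ (λ k → ∧-assoc (M i l) (N l k) (P k j))) ⟩
  ∑[ l < m ] ∑[ k < m ] (M i l ∧ (N l k ∧ P k j))           ≡⟨ sum-cong-≗ (λ l → *-distribˡ-sum (M i l) (λ k → N l k ∧ P k j)) ⟨
  ∑[ l < m ] (M i l ∧ ∑[ k < m ] (N l k ∧ P k j))           ≡⟨ sum-cong-≗ (λ l → cong (M i l ∧_) (dot≡∑ (N l) (λ k → P k j))) ⟨
  ∑[ l < m ] (M i l ∧ dot (N l) (λ k → P k j))              ≡⟨ dot≡∑ (M i) (λ l → dot (N l) (λ k → P k j)) ⟨
  dot (M i) (λ l → dot (N l) (λ k → P k j))                 ∎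
  where open ≡-Reasoning

inverseʳ⇒inverseˡ : ∀ {m} (C X : Mat m) →
                    (∀ u → (∀ i → (C ·ᵥ u) i ≡ false) → ∀ i → u i ≡ false) →
                    (∀ i j → (C ·ₘ X) i j ≡ 𝟙 i j) → ∀ i j → (X ·ₘ C) i j ≡ 𝟙 i j
inverseʳ⇒inverseˡ C X ker-trivial CX≡𝟙 i j = xor≡false⇒≡ _ _ (ker-trivial difference C·difference≡0 i)
  where
  difference : Fin _ → Bool
  difference k = (X ·ₘ C) k j xor 𝟙 k j
  C·difference≡0 : ∀ r → (C ·ᵥ difference) r ≡ false
  C·difference≡0 r = begin
    (C ·ᵥ difference) r                          ≡⟨ ·ᵥ-xor C _ _ r ⟩
    (C ·ₘ (X ·ₘ C)) r j xor (C ·ₘ 𝟙) r j         ≡⟨ cong₂ _xor_ (sym (·ₘ-assoc C X C r j)) (·ₘ-identityʳ C r j) ⟩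
    ((C ·ₘ X) ·ₘ C) r j xor C r j                ≡⟨ cong (_xor C r j) (·ₘ-congˡ C CX≡𝟙 r j) ⟩
    (𝟙 ·ₘ C) r j xor C r j                       ≡⟨ cong (_xor C r j) (·ₘ-identityˡ C r j) ⟩
    C r j xor C r j                              ≡⟨ xor-same (C r j) ⟩
    false                                        ∎
    where open ≡-Reasoning

-- Prefixes and binary expansions

PrefixEq : ∀ {m} → ℕ → (Fin m → Bool) → (Fin m → Bool) → Set
PrefixEq k y z = ∀ i → toℕ i < k → y i ≡ z i

PrefixZero : ∀ {m} → ℕ → (Fin m → Bool) → Set
PrefixZero k y = PrefixEq k y (λ _ → false)

PrefixEq-mono : ∀ {m k k'} {y z : Fin m → Bool} → k ≤ k' → PrefixEq k' y z → PrefixEq k y z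
PrefixEq-mono k≤k' y≐z i i<k = y≐z i (≤-trans i<k k≤k')

PrefixEq-extend : ∀ {m} {y z : Fin m → Bool} (ι : Fin m) → PrefixEq (toℕ ι) y z → y ι ≡ z ι → PrefixEq (suc (toℕ ι)) y z
PrefixEq-extend {y = y} {z} ι y≐z yι≡zι i i<1+ι with m≤n⇒m<n∨m≡n (s≤s⁻¹ i<1+ι)
... | inj₁ i<ι = y≐z i i<ι
... | inj₂ i≡ι = subst (λ j → y j ≡ z j) (sym (toℕ-injective i≡ι)) yι≡zι

PrefixZero-xor : ∀ {m k} (M : Mat m) {x y : Fin m → Bool} →
                 PrefixZero k (M ·ᵥ x) → PrefixZero k (M ·ᵥ y) → PrefixZero k (M ·ᵥ (λ r → x r xor y r))
PrefixZero-xor M {x} {y} Mx≐0 My≐0 i i<k = trans (·ᵥ-xor M x y i) (cong₂ _xor_ (Mx≐0 i i<k) (My≐0 i i<k))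

prefixValue : ℕ → ∀ {m} → (Fin m → Bool) → ℕ
prefixValue zero    y = 0
prefixValue (suc d) {zero}  y = 0
prefixValue (suc d) {suc m} y = (if y fzero then 2 ^ d else 0) + prefixValue d (y ∘ fsuc)

prefixValue<2^ : ∀ d {m} (y : Fin m → Bool) → prefixValue d y < 2 ^ d
prefixValue<2^ zero    y = s≤s z≤n
prefixValue<2^ (suc d) {zero}  y = m^n>0 2 (suc d)
prefixValue<2^ (suc d) {suc m} y with y fzero
... | true  = +-monoʳ-< (2 ^ d) (≤-trans (prefixValue<2^ d (y ∘ fsuc)) (m≤m+n (2 ^ d) 0))
... | false = ≤-trans (prefixValue<2^ d (y ∘ fsuc)) (m≤m+n (2 ^ d) _)

scaledφ≡prefixValue : ∀ m (y : Fin m → Bool) → scaledφ m y ≡ prefixValue m y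
scaledφ≡prefixValue zero    y = refl
scaledφ≡prefixValue (suc m) y = cong ((if y fzero then 2 ^ m else 0) +_) (scaledφ≡prefixValue m (y ∘ fsuc))

prefixValue-cong : ∀ d {m} {y z : Fin m → Bool} → PrefixEq d y z → prefixValue d y ≡ prefixValue d z
prefixValue-cong zero    y≐z = refl
prefixValue-cong (suc d) {zero}  y≐z = refl
prefixValue-cong (suc d) {suc m} y≐z =
  cong₂ (λ b r → (if b then 2 ^ d else 0) + r) (y≐z fzero z<s) (prefixValue-cong d (λ i i<d → y≐z (fsuc i) (s<s i<d)))

prefixValue-injective : ∀ d {m} (y z : Fin m → Bool) → prefixValue d y ≡ prefixValue d z → PrefixEq d y z
prefixValue-injective (suc d) {suc m} y z eq i i<1+d with y fzero in y₀ | z fzero in z₀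
prefixValue-injective (suc d) {suc m} y z eq fzero _ | true  | true  = trans y₀ (sym z₀)
prefixValue-injective (suc d) {suc m} y z eq fzero _ | false | false = trans y₀ (sym z₀)
prefixValue-injective (suc d) {suc m} y z eq (fsuc i) (s<s i<d) | true  | true =
  prefixValue-injective d (y ∘ fsuc) (z ∘ fsuc) (+-cancelˡ-≡ (2 ^ d) _ _ eq) i i<d
prefixValue-injective (suc d) {suc m} y z eq (fsuc i) (s<s i<d) | false | false =
  prefixValue-injective d (y ∘ fsuc) (z ∘ fsuc) eq i i<d
prefixValue-injective (suc d) {suc m} y z eq i _ | true  | false =
  contradiction (subst (2 ^ d ≤_) eq (m≤m+n (2 ^ d) _)) (<⇒≱ (prefixValue<2^ d (z ∘ fsuc)))
prefixValue-injective (suc d) {suc m} y z eq i _ | false | true  =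
  contradiction (subst (2 ^ d ≤_) (sym eq) (m≤m+n (2 ^ d) _)) (<⇒≱ (prefixValue<2^ d (y ∘ fsuc)))

digit*2^ : ∀ b {d m} → d ≤ m → (if b then 2 ^ d else 0) * 2 ^ (m ∸ d) ≡ (if b then 2 ^ m else 0)
digit*2^ true  {d} {m} d≤m = trans (sym (^-distribˡ-+-* 2 d (m ∸ d))) (cong (2 ^_) (m+[n∸m]≡n d≤m))
digit*2^ false         d≤m = refl

prefixValue-split : ∀ {d m} (y : Fin m → Bool) → d ≤ m →
                    Σ ℕ λ r → r < 2 ^ (m ∸ d) × scaledφ m y ≡ prefixValue d y * 2 ^ (m ∸ d) + r
prefixValue-split {zero}  {m} y _ = scaledφ m y , subst (_< 2 ^ m) (sym (scaledφ≡prefixValue m y)) (prefixValue<2^ m y) , refl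
prefixValue-split {suc d} {suc m} y (s≤s d≤m) with prefixValue-split (y ∘ fsuc) d≤m
... | r , r<P , φ≡ = r , r<P , (begin
  digitₘ + scaledφ m (y ∘ fsuc)                    ≡⟨ cong₂ _+_ (sym (digit*2^ (y fzero) d≤m)) φ≡ ⟩
  digitₐ * P + (prefixValue d (y ∘ fsuc) * P + r)  ≡⟨ sym (+-assoc (digitₐ * P) _ r) ⟩
  digitₐ * P + prefixValue d (y ∘ fsuc) * P + r    ≡⟨ cong (_+ r) (sym (*-distribʳ-+ P digitₐ _)) ⟩
  (digitₐ + prefixValue d (y ∘ fsuc)) * P + r      ∎)
  where
  open ≡-Reasoning
  P digitₐ digitₘ : ℕ
  P = 2 ^ (m ∸ d)
  digitₐ = if y fzero then 2 ^ d else 0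
  digitₘ = if y fzero then 2 ^ m else 0

-- The i-th conjunct of inBox, definitionally.
inDyadicInterval : (m d a : ℕ) → (Fin m → Bool) → Bool
inDyadicInterval m d a y = (a * 2 ^ (m ∸ d) ≤ᵇ scaledφ m y) ∧ (scaledφ m y <ᵇ suc a * 2 ^ (m ∸ d))

inDyadicInterval⇔ : ∀ {m d} a (y : Fin m → Bool) → d ≤ m → T (inDyadicInterval m d a y) ⇔ (a ≡ prefixValue d y)
inDyadicInterval⇔ {m} {d} a y d≤m with prefixValue-split y d≤m
... | r , r<P , φ≡ = mk⇔ to from
  where
  P L φ : ℕ
  P = 2 ^ (m ∸ d)
  L = prefixValue d y
  φ = scaledφ m y
  lower : L * P ≤ φ
  lower = subst (L * P ≤_) (sym φ≡) (m≤m+n (L * P) r)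
  upper : φ < suc L * P
  upper = subst (_< suc L * P) (sym φ≡) (subst (L * P + r <_) (+-comm (L * P) P) (+-monoʳ-< (L * P) r<P))
  to : T (inDyadicInterval m d a y) → a ≡ L
  to inside with Equivalence.to T-∧ inside
  ... | aP≤φ , φ<[1+a]P = ≤-antisym
    (s≤s⁻¹ (*-cancelʳ-< P a (suc L) (≤-<-trans (≤ᵇ⇒≤ _ _ aP≤φ) upper)))
    (s≤s⁻¹ (*-cancelʳ-< P L (suc a) (≤-<-trans lower (<ᵇ⇒< _ _ φ<[1+a]P))))
  from : a ≡ L → T (inDyadicInterval m d a y)
  from refl = Equivalence.from T-∧ (≤⇒≤ᵇ lower , <⇒<ᵇ upper)

inDyadicInterval-prefixValue⇔ : ∀ {m d} (y α : Fin m → Bool) → d ≤ m →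
                                T (inDyadicInterval m d (prefixValue d α) y) ⇔ PrefixEq d y α
inDyadicInterval-prefixValue⇔ {d = d} y α d≤m = mk⇔
  (λ inside → prefixValue-injective d y α (sym (Equivalence.to (inDyadicInterval⇔ (prefixValue d α) y d≤m) inside)))
  (λ y≐α → Equivalence.from (inDyadicInterval⇔ (prefixValue d α) y d≤m) (sym (prefixValue-cong d y≐α)))

bit : Bool → ℕ
bit b = if b then 1 else 0

bit<2 : ∀ b → bit b < 2
bit<2 true  = s≤s (s≤s z≤n)
bit<2 false = s≤s z≤n

bit-T : ∀ {b} → T b → bit b ≡ 1
bit-T {true} _ = refl

fromBits : ∀ m → (Fin m → Bool) → ℕ
fromBits zero    x = 0
fromBits (suc m) x = bit (x fzero) + fromBits m (x ∘ fsuc) * 2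

fromBits<2^ : ∀ m (x : Fin m → Bool) → fromBits m x < 2 ^ m
fromBits<2^ zero    x = s≤s z≤n
fromBits<2^ (suc m) x = begin-strict
  bit (x fzero) + fromBits m (x ∘ fsuc) * 2               ≤⟨ +-monoˡ-≤ _ (s≤s⁻¹ (bit<2 (x fzero))) ⟩
  1 + fromBits m (x ∘ fsuc) * 2                           <⟨ n<1+n _ ⟩
  suc (fromBits m (x ∘ fsuc)) * 2                         ≤⟨ *-monoˡ-≤ 2 (fromBits<2^ m (x ∘ fsuc)) ⟩
  2 ^ m * 2                                               ≡⟨ *-comm (2 ^ m) 2 ⟩
  2 ^ suc m                                               ∎
  where
  open ≤-Reasoning

bitsOf-0 : ∀ m (i : Fin m) → bitsOf m 0 i ≡ false
bitsOf-0 (suc m) fzero    = refl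
bitsOf-0 (suc m) (fsuc i) = bitsOf-0 m i

bitsOf-fromBits : ∀ m (x : Fin m → Bool) (i : Fin m) → bitsOf m (fromBits m x) i ≡ x i
bitsOf-fromBits (suc m) x fzero    = trans (cong (_≡ᵇ 1) ([m+kn]%n≡m%n (bit (x fzero)) (fromBits m (x ∘ fsuc)) 2)) (bit-parity (x fzero))
  where
  bit-parity : ∀ b → (bit b % 2 ≡ᵇ 1) ≡ b
  bit-parity true  = refl
  bit-parity false = refl
bitsOf-fromBits (suc m) x (fsuc i) = trans (cong (λ l → bitsOf m l i) half) (bitsOf-fromBits m (x ∘ fsuc) i)
  where
  k : ℕ
  k = fromBits m (x ∘ fsuc)
  half : (bit (x fzero) + k * 2) / 2 ≡ k
  half = begin
    (bit (x fzero) + k * 2) / 2      ≡⟨ +-distrib-/-∣ʳ (bit (x fzero)) (divides k refl) ⟩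
    bit (x fzero) / 2 + k * 2 / 2    ≡⟨ cong₂ _+_ (m<n⇒m/n≡0 (bit<2 (x fzero))) (m*n/n≡m k 2) ⟩
    k                                ∎
    where open ≡-Reasoning

-- Digital nets with t-value 0

count : ∀ {A : Set} → (A → Bool) → List A → ℕ
count P xs = ℕ.sum (map (λ x → bit (P x)) xs)

count-∈ : ∀ {A : Set} (P : A → Bool) {x xs} → x ∈ xs → T (P x) → 1 ≤ count P xs
count-∈ P (here refl) Px = ≤-trans (≤-reflexive (sym (bit-T Px))) (m≤m+n _ _)
count-∈ P (there x∈) Px = ≤-trans (count-∈ P x∈ Px) (m≤n+m _ _)

count-∈₂ : ∀ {A : Set} (P : A → Bool) {x y xs} → x ≢ y → x ∈ xs → y ∈ xs → T (P x) → T (P y) → 2 ≤ count P xs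
count-∈₂ P x≢y (here refl) (here refl) Px Py = contradiction refl x≢y
count-∈₂ P x≢y (here refl) (there y∈) Px Py = +-mono-≤ (≤-reflexive (sym (bit-T Px))) (count-∈ P y∈ Py)
count-∈₂ P x≢y (there x∈) (here refl) Px Py = +-mono-≤ (≤-reflexive (sym (bit-T Py))) (count-∈ P x∈ Px)
count-∈₂ P x≢y (there x∈) (there y∈) Px Py = ≤-trans (count-∈₂ P x≢y x∈ y∈ Px Py) (m≤n+m _ _)

count-pos : ∀ {A : Set} (P : A → Bool) xs → 0 < count P xs → Σ A λ x → x ∈ xs × T (P x)
count-pos P (x List.∷ xs) pos with P x in Px
... | true  = x , here refl , subst T (sym Px) _
... | false with count-pos P xs pos
...   | y , y∈ , Py = y , there y∈ , Py

T-and-allFin⇔ : ∀ {s} (f : Fin s → Bool) → T (and (map f (allFin s))) ⇔ (∀ j → T (f j))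
T-and-allFin⇔ {s} f = mk⇔ (λ all-f → All.tabulate⁻ (All.all⁺ f (allFin s) all-f))
                           (λ f-holds → All.all⁻ f (All.tabulate⁺ f-holds))

≤-sum-tabulate : ∀ {s} (d : Fin s → ℕ) (j : Fin s) → d j ≤ ℕ.sum (tabulate d)
≤-sum-tabulate d fzero    = m≤m+n _ _
≤-sum-tabulate d (fsuc j) = ≤-trans (≤-sum-tabulate (d ∘ fsuc) j) (m≤n+m _ _)

module _ {m s} {Cs : Fin s → Mat m} (net : IsNet m s Cs 0) {d : Fin s → ℕ} (Σd≡m : ℕ.sum (map d (allFin s)) ≡ m) where

  private
    d≤m : ∀ j → d j ≤ m
    d≤m j = subst (d j ≤_) (trans (cong ℕ.sum (sym (map-tabulate id d))) Σd≡m) (≤-sum-tabulate d j)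

    inBox-prefixValue⇔ : (α : Fin s → Fin m → Bool) (l : ℕ) →
                         T (inBox m s Cs d (λ j → prefixValue (d j) (α j)) l) ⇔
                         (∀ j → PrefixEq (d j) (Cs j ·ᵥ bitsOf m l) (α j))
    inBox-prefixValue⇔ α l = mk⇔
      (λ inside j → Equivalence.to (coordinate⇔ j) (Equivalence.to (T-and-allFin⇔ _) inside j))
      (λ agree → Equivalence.from (T-and-allFin⇔ _) (λ j → Equivalence.from (coordinate⇔ j) (agree j)))
      where
      coordinate⇔ : ∀ j → T (inDyadicInterval m (d j) (prefixValue (d j) (α j)) (Cs j ·ᵥ bitsOf m l)) ⇔
                          PrefixEq (d j) (Cs j ·ᵥ bitsOf m l) (α j)
      coordinate⇔ j = inDyadicInterval-prefixValue⇔ (Cs j ·ᵥ bitsOf m l) (α j) (d≤m j)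

    one-point : (α : Fin s → Fin m → Bool) →
                count (inBox m s Cs d (λ j → prefixValue (d j) (α j))) (upTo (2 ^ m)) ≡ 1
    one-point α = proj₂ net d Σd≡m (λ j → prefixValue (d j) (α j)) (λ j → prefixValue<2^ (d j) (α j))

  net-surjective : (α : Fin s → Fin m → Bool) → Σ (Fin m → Bool) λ x → ∀ j → PrefixEq (d j) (Cs j ·ᵥ x) (α j)
  net-surjective α with count-pos _ (upTo (2 ^ m)) (subst (0 <_) (sym (one-point α)) z<s)
  ... | l , _ , inside = bitsOf m l , Equivalence.to (inBox-prefixValue⇔ α l) inside

  -- The points with indices 0 and fromBits m x share the elementary box of target 0.
  net-injective : (x : Fin m → Bool) → (∀ j → PrefixZero (d j) (Cs j ·ᵥ x)) → ∀ i → x i ≡ false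
  net-injective x Csx≐0 i = begin
    x i                             ≡⟨ bitsOf-fromBits m x i ⟨
    bitsOf m (fromBits m x) i       ≡⟨ cong (λ l → bitsOf m l i) fromBits≡0 ⟩
    bitsOf m 0 i                    ≡⟨ bitsOf-0 m i ⟩
    false                           ∎
    where
    open ≡-Reasoning
    0⃗ : Fin s → Fin m → Bool
    0⃗ _ _ = false
    0-inside : T (inBox m s Cs d (λ j → prefixValue (d j) (0⃗ j)) 0)
    0-inside = Equivalence.from (inBox-prefixValue⇔ 0⃗ 0) (λ j r _ → ·ᵥ-zero (Cs j) (bitsOf-0 m) r)
    x-inside : T (inBox m s Cs d (λ j → prefixValue (d j) (0⃗ j)) (fromBits m x))
    x-inside = Equivalence.from (inBox-prefixValue⇔ 0⃗ (fromBits m x))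
                 (λ j r r<d → trans (·ᵥ-cong (Cs j) (bitsOf-fromBits m x) r) (Csx≐0 j r r<d))
    fromBits≡0 : fromBits m x ≡ 0
    fromBits≡0 with fromBits m x ≟ 0
    ... | yes x≡0 = x≡0
    ... | no  x≢0 = contradiction (subst (2 ≤_) (one-point 0⃗) two-points) λ { (s≤s ()) }
      where
      two-points : 2 ≤ count (inBox m s Cs d (λ j → prefixValue (d j) (0⃗ j))) (upTo (2 ^ m))
      two-points = count-∈₂ _ (x≢0 ∘ sym) (∈-upTo⁺ (m^n>0 2 m)) (∈-upTo⁺ (fromBits<2^ m x)) 0-inside x-inside

module _ {m} {A B C : Mat m} (net : IsNet m 3 (A ∷ B ∷ C ∷ []) 0) where

  private
    Σ₃≡m : ∀ p q k → p + q + k ≡ m → p + (q + (k + 0)) ≡ m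
    Σ₃≡m p q k p+q+k≡m = trans (cong (λ r → p + (q + r)) (+-identityʳ k)) (trans (sym (+-assoc p q k)) p+q+k≡m)

  net₃-injective : ∀ {p q k} → p + q + k ≡ m → (x : Fin m → Bool) →
                   PrefixZero p (A ·ᵥ x) → PrefixZero q (B ·ᵥ x) → PrefixZero k (C ·ᵥ x) → ∀ i → x i ≡ false
  net₃-injective {p} {q} {k} p+q+k≡m x Ax≐0 Bx≐0 Cx≐0 =
    net-injective {Cs = A ∷ B ∷ C ∷ []} net {p ∷ q ∷ k ∷ []} (Σ₃≡m p q k p+q+k≡m) x
      λ { fzero → Ax≐0 ; (fsuc fzero) → Bx≐0 ; (fsuc (fsuc fzero)) → Cx≐0 }

  net₃-surjective : ∀ {p q k} → p + q + k ≡ m → (γ : Fin m → Bool) →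
                    Σ (Fin m → Bool) λ x → PrefixZero p (A ·ᵥ x) × PrefixZero q (B ·ᵥ x) × PrefixEq k (C ·ᵥ x) γ
  net₃-surjective {p} {q} {k} p+q+k≡m γ
    with net-surjective {Cs = A ∷ B ∷ C ∷ []} net {p ∷ q ∷ k ∷ []} (Σ₃≡m p q k p+q+k≡m) ((λ _ → false) ∷ (λ _ → false) ∷ γ ∷ [])
  ... | x , agree = x , agree fzero , agree (fsuc fzero) , agree (fsuc (fsuc fzero))

  net₃-rightInverse : Σ (Mat m) λ X → ∀ i j → (C ·ₘ X) i j ≡ 𝟙 i j
  net₃-rightInverse = (λ i j → proj₁ (column j) i) , λ i j → proj₂ (proj₂ (proj₂ (column j))) i (toℕ<n i)
    where
    column : (j : Fin m) → Σ (Fin m → Bool) λ x →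
             PrefixZero 0 (A ·ᵥ x) × PrefixZero 0 (B ·ᵥ x) × PrefixEq m (C ·ᵥ x) (λ r → 𝟙 r j)
    column j = net₃-surjective {0} {0} refl (λ r → 𝟙 r j)

-- Two nets sharing A and B

module TwoNets {m} {A B C C' : Mat m} (net : IsNet m 3 (A ∷ B ∷ C ∷ []) 0) (net' : IsNet m 3 (A ∷ B ∷ C' ∷ []) 0) where

  PrefixKernel⊆ : ℕ → Set
  PrefixKernel⊆ k = ∀ x → PrefixZero k (C ·ᵥ x) → PrefixZero k (C' ·ᵥ x)

  module _ (ι : Fin m) (ker⊆ : PrefixKernel⊆ (toℕ ι)) where

    private
      k : ℕ
      k = toℕ ι

      discrepancy : (Fin m → Bool) → Bool
      discrepancy x = (C ·ᵥ x) ι xor (C' ·ᵥ x) ι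

      discrepancy-xor : ∀ x y → discrepancy (λ r → x r xor y r) ≡ discrepancy x xor discrepancy y
      discrepancy-xor x y = trans (cong₂ _xor_ (·ᵥ-xor C x y ι) (·ᵥ-xor C' x y ι))
                                  (interchange ((C ·ᵥ x) ι) ((C ·ᵥ y) ι) ((C' ·ᵥ x) ι) ((C' ·ᵥ y) ι))

      -- v is the preimage of e_ι for the profile (toℕ π, q, k + 1); injectivity of the two nets
      -- forces (Av)_π = 1 and (C'v)_ι = 1.
      pivot : (π : Fin m) (q : ℕ) → toℕ π + q + suc k ≡ m →
              Σ (Fin m → Bool) λ v → PrefixZero (toℕ π) (A ·ᵥ v) × (A ·ᵥ v) π ≡ true ×
                                     PrefixZero k (C ·ᵥ v) × discrepancy v ≡ false
      pivot π q π+q+1+k≡m with net₃-surjective net π+q+1+k≡m (λ r → 𝟙 r ι)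
      ... | v , Av≐0 , Bv≐0 , Cv≐𝟙 = v , Av≐0 , Avπ≡1 , Cv≐0 , cong₂ _xor_ Cvι≡1 C'vι≡1
        where
        Cvι≡1 : (C ·ᵥ v) ι ≡ true
        Cvι≡1 = trans (Cv≐𝟙 ι (n<1+n k)) (𝟙-diag ι)
        Cv≐0 : PrefixZero k (C ·ᵥ v)
        Cv≐0 i i<k = trans (Cv≐𝟙 i (m<n⇒m<1+n i<k)) (𝟙-upper i ι i<k)
        v≢0 : ¬ (∀ i → v i ≡ false)
        v≢0 v≡0 = contradiction (trans (sym Cvι≡1) (·ᵥ-zero C v≡0 ι)) λ ()
        Avπ≡1 : (A ·ᵥ v) π ≡ true
        Avπ≡1 = ¬-not λ Avπ≡0 → v≢0 (net₃-injective net (trans (sym (+-suc (toℕ π + q) k)) π+q+1+k≡m) v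
                                       (PrefixEq-extend π Av≐0 Avπ≡0) Bv≐0 Cv≐0)
        C'vι≡1 : (C' ·ᵥ v) ι ≡ true
        C'vι≡1 = ¬-not λ C'vι≡0 → v≢0 (net₃-injective net' π+q+1+k≡m v Av≐0 Bv≐0
                                         (PrefixEq-extend ι (ker⊆ v Cv≐0) C'vι≡0))

      -- Either x or x + v vanishes on one more coordinate of its A-prefix, and v does not change the discrepancy.
      eliminate : (π : Fin m) (n : ℕ) → toℕ π + suc n + k ≡ m →
                  (∀ y → PrefixZero (suc (toℕ π)) (A ·ᵥ y) → PrefixZero k (C ·ᵥ y) → discrepancy y ≡ false) →
                  ∀ x → PrefixZero (toℕ π) (A ·ᵥ x) → PrefixZero k (C ·ᵥ x) → discrepancy x ≡ false
      eliminate π n π+1+n+k≡m vanishes x Ax≐0 Cx≐0 with pivot π n π+n+1+k≡m | (A ·ᵥ x) π in Axπ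
        where
        π+n+1+k≡m : toℕ π + n + suc k ≡ m
        π+n+1+k≡m = trans (+-suc (toℕ π + n) k) (trans (cong (_+ k) (sym (+-suc (toℕ π) n))) π+1+n+k≡m)
      ... | _ | false = vanishes x (PrefixEq-extend π Ax≐0 Axπ) Cx≐0
      ... | v , Av≐0 , Avπ≡1 , Cv≐0 , discrepancy-v | true = begin
        discrepancy x                       ≡⟨ xor-identityʳ _ ⟨
        discrepancy x xor false             ≡⟨ cong (discrepancy x xor_) discrepancy-v ⟨
        discrepancy x xor discrepancy v     ≡⟨ discrepancy-xor x v ⟨
        discrepancy (λ r → x r xor v r)     ≡⟨ vanishes _ A[x+v]≐0 (PrefixZero-xor C Cx≐0 Cv≐0) ⟩
        false                               ∎
        where
        open ≡-Reasoning
        A[x+v]≐0 : PrefixZero (suc (toℕ π)) (A ·ᵥ (λ r → x r xor v r))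
        A[x+v]≐0 = PrefixEq-extend π (PrefixZero-xor A Ax≐0 Av≐0) (trans (·ᵥ-xor A x v π) (cong₂ _xor_ Axπ Avπ≡1))

      discrepancy-vanishes : ∀ n p → p + n + k ≡ m →
                             ∀ x → PrefixZero p (A ·ᵥ x) → PrefixZero k (C ·ᵥ x) → discrepancy x ≡ false
      discrepancy-vanishes zero    p p+k≡m x Ax≐0 Cx≐0 = cong₂ _xor_ (·ᵥ-zero C x≡0 ι) (·ᵥ-zero C' x≡0 ι)
        where
        x≡0 : ∀ i → x i ≡ false
        x≡0 = net₃-injective net p+k≡m x Ax≐0 (λ _ ()) Cx≐0
      discrepancy-vanishes (suc n) p p+1+n+k≡m x Ax≐0 Cx≐0 =
        eliminate π n (subst (λ r → r + suc n + k ≡ m) (sym π≡p) p+1+n+k≡m)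
                  (discrepancy-vanishes n (suc (toℕ π)) (subst (λ r → suc r + n + k ≡ m) (sym π≡p) p+1+n+k≡m'))
                  x (subst (λ r → PrefixZero r (A ·ᵥ x)) (sym π≡p) Ax≐0) Cx≐0
        where
        p<m : p < m
        p<m = subst (p <_) p+1+n+k≡m (≤-trans (m<m+n p z<s) (m≤m+n (p + suc n) k))
        π : Fin m
        π = fromℕ< p<m
        π≡p : toℕ π ≡ p
        π≡p = toℕ-fromℕ< p<m
        p+1+n+k≡m' : suc p + n + k ≡ m
        p+1+n+k≡m' = trans (cong (_+ k) (sym (+-suc p n))) p+1+n+k≡m

    row-agrees : ∀ x → PrefixZero k (C ·ᵥ x) → (C ·ᵥ x) ι ≡ (C' ·ᵥ x) ι
    row-agrees x Cx≐0 =
      xor≡false⇒≡ _ _ (discrepancy-vanishes (m ∸ k) 0 (m∸n+n≡m (<⇒≤ (toℕ<n ι))) x (λ _ ()) Cx≐0)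

  prefixKernel⊆ : ∀ k → k ≤ m → PrefixKernel⊆ k
  prefixKernel⊆ zero    _     x _ _ ()
  prefixKernel⊆ (suc k) 1+k≤m x Cx≐0 = subst (λ r → PrefixZero (suc r) (C' ·ᵥ x)) ι≡k
    (PrefixEq-extend ι (ker⊆ x Cx≐0') (trans (sym (row-agrees ι ker⊆ x Cx≐0')) (Cx≐0 ι (s≤s (≤-reflexive ι≡k)))))
    where
    ι : Fin m
    ι = fromℕ< 1+k≤m
    ι≡k : toℕ ι ≡ k
    ι≡k = toℕ-fromℕ< 1+k≤m
    ker⊆ : PrefixKernel⊆ (toℕ ι)
    ker⊆ = subst PrefixKernel⊆ (sym ι≡k) (prefixKernel⊆ k (<⇒≤ 1+k≤m))
    Cx≐0' : PrefixZero (toℕ ι) (C ·ᵥ x)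
    Cx≐0' = PrefixEq-mono (≤-trans (≤-reflexive ι≡k) (n≤1+n k)) Cx≐0

  rows-agree : (ι : Fin m) → ∀ x → PrefixZero (toℕ ι) (C ·ᵥ x) → (C ·ᵥ x) ι ≡ (C' ·ᵥ x) ι
  rows-agree ι = row-agrees ι (prefixKernel⊆ (toℕ ι) (<⇒≤ (toℕ<n ι)))

lemma9 : (m : ℕ) (A B C C' : Mat m) →
         HasTValue m 3 (A ∷ B ∷ C ∷ []) 0 →
         HasTValue m 3 (A ∷ B ∷ C' ∷ []) 0 →
         Σ (Mat m) (λ L → IsUnitLowerTriangular L × (∀ i j → (L ·ₘ C) i j ≡ C' i j))
lemma9 m A B C C' (net , _) (net' , _) = C' ·ₘ X , (upper-zero , diagonal-one) , product
  where
  open TwoNets net net'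
  X : Mat m
  X = proj₁ (net₃-rightInverse net)
  CX≡𝟙 : ∀ i j → (C ·ₘ X) i j ≡ 𝟙 i j
  CX≡𝟙 = proj₂ (net₃-rightInverse net)
  XC≡𝟙 : ∀ i j → (X ·ₘ C) i j ≡ 𝟙 i j
  XC≡𝟙 = inverseʳ⇒inverseˡ C X (λ u Cu≡0 → net₃-injective net {0} {0} refl u (λ _ ()) (λ _ ()) (λ i _ → Cu≡0 i))
                             CX≡𝟙
  CXⱼ≐0 : ∀ j → PrefixZero (toℕ j) (C ·ᵥ (λ k → X k j))
  CXⱼ≐0 j i i<j = trans (CX≡𝟙 i j) (𝟙-upper i j i<j)
  upper-zero : ∀ i j → toℕ i < toℕ j → (C' ·ₘ X) i j ≡ false
  upper-zero i j = prefixKernel⊆ (toℕ j) (<⇒≤ (toℕ<n j)) (λ k → X k j) (CXⱼ≐0 j) i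
  diagonal-one : ∀ i → (C' ·ₘ X) i i ≡ true
  diagonal-one i = begin
    (C' ·ₘ X) i i  ≡⟨ rows-agree i (λ k → X k i) (CXⱼ≐0 i) ⟨
    (C ·ₘ X) i i   ≡⟨ CX≡𝟙 i i ⟩
    𝟙 i i          ≡⟨ 𝟙-diag i ⟩
    true           ∎
    where open ≡-Reasoning
  product : ∀ i j → ((C' ·ₘ X) ·ₘ C) i j ≡ C' i j
  product i j = begin
    ((C' ·ₘ X) ·ₘ C) i j  ≡⟨ ·ₘ-assoc C' X C i j ⟩
    (C' ·ₘ (X ·ₘ C)) i j  ≡⟨ ·ₘ-congʳ C' XC≡𝟙 i j ⟩
    (C' ·ₘ 𝟙) i j         ≡⟨ ·ₘ-identityʳ C' i j ⟩
    C' i j                ∎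
    where open ≡-Reasoning
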